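{- For every integer $n\ge 4$, the crown graph $\mathrm{Cr}(2n)$ is a graph of girth $4$ that is $1/(n-2)$-RA.
   Context: The crown graph $\mathrm{Cr}(2n)$ has vertices $1,\dots,n,1',\dots,n'$, with $i$ adjacent to $j'$ iff $i\neq j$ (no other edges). $N[v]$ is the closed neighbourhood; for a vertex set $S$, $\vec S$ is its $0/1$ indicator vector. The RA matrix $C_\Gamma$ of a graph $\Gamma$ on $m$ vertices has $m$ columns and rows $\vec{N[v]}$ for all vertices $v$ together with $\overrightarrow{N[u]\cap N[v]}$ for all pairs $u,v$. For $k\ge1$, $\Gamma$ is $1/k$-RA if for every ordering of the columns of $C_\Gamma$, the diagonal of the Hermite normal form of $C_\Gamma$ is $(1,\dots,1,k)$ ($m-1$ ones). -}

module Defs where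

open import Data.Nat using (ℕ; zero; suc; _+_; _∸_; _≤_; _<_)
open import Data.Integer as ℤ using (ℤ; +_; 0ℤ; 1ℤ)
open import Data.Fin using (Fin; zero; suc; toℕ; splitAt; _≟_)
open import Data.Fin.Permutation using (Permutation′; _⟨$⟩ʳ_)
open import Data.Bool using (Bool; true; false; if_then_else_; _∧_; _∨_; not)
open import Data.Sum using (_⊎_; inj₁; inj₂)
open import Data.Product using (Σ; _×_; _,_; ∃)
open import Data.List using (List; []; _∷_; _++_; map; concatMap; length; allFin; lookup)
open import Data.Maybe using (Maybe; just; nothing)
open import Relation.Nullary using (¬_; does)
open import Relation.Binary.PropositionalEquality using (_≡_)
open import Function.Definitions using (Injective)

record Graph (m : ℕ) : Set where
  field
    adj   : Fin m → Fin m → Bool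
    sym   : ∀ u v → adj u v ≡ adj v u
    irrefl : ∀ v → adj v v ≡ false
open Graph public

-- the crown graph Cr(2n): vertices Fin (n + n); the first n are 1..n,
-- the last n are 1'..n'; i ~ j' iff i ≠ j, no other edges.
crownAdj : (n : ℕ) → Fin (n + n) → Fin (n + n) → Bool
crownAdj n u v with splitAt n u | splitAt n v
... | inj₁ i | inj₂ j = not (does (i ≟ j))
... | inj₂ j | inj₁ i = not (does (i ≟ j))
... | inj₁ _ | inj₁ _ = false
... | inj₂ _ | inj₂ _ = false

crownSym : (n : ℕ) → ∀ u v → crownAdj n u v ≡ crownAdj n v u
crownSym n u v with splitAt n u | splitAt n v
... | inj₁ i | inj₂ j = _≡_.refl
... | inj₂ j | inj₁ i = _≡_.refl
... | inj₁ _ | inj₁ _ = _≡_.refl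
... | inj₂ _ | inj₂ _ = _≡_.refl

crownIrrefl : (n : ℕ) → ∀ v → crownAdj n v v ≡ false
crownIrrefl n v with splitAt n v
... | inj₁ _ = _≡_.refl
... | inj₂ _ = _≡_.refl

Crown : (n : ℕ) → Graph (n + n)
Crown n = record { adj = crownAdj n ; sym = crownSym n ; irrefl = crownIrrefl n }

HasCycle : ∀ {m} → Graph m → ℕ → Set
HasCycle {m} G k =
  3 ≤ k × Σ (Fin k → Fin m) λ f → Injective _≡_ _≡_ f ×
    (∀ (i j : Fin k) → (toℕ j ≡ suc (toℕ i) ⊎ (suc (toℕ i) ≡ k × toℕ j ≡ 0)) →
       adj G (f i) (f j) ≡ true)

HasGirth : ∀ {m} → Graph m → ℕ → Set
HasGirth G g = HasCycle G g × (∀ k → HasCycle G k → g ≤ k)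

Matrix : ℕ → ℕ → Set
Matrix r c = Fin r → Fin c → ℤ

∑ : ∀ {n} → (Fin n → ℤ) → ℤ
∑ {zero}  f = 0ℤ
∑ {suc n} f = f zero ℤ.+ ∑ (λ i → f (suc i))

_⊗_ : ∀ {r s c} → Matrix r s → Matrix s c → Matrix r c
(A ⊗ B) i j = ∑ (λ k → A i k ℤ.* B k j)

idMatrix : ∀ {r} → Matrix r r
idMatrix i j = if does (i ≟ j) then 1ℤ else 0ℤ

_≋_ : ∀ {r c} → Matrix r c → Matrix r c → Set
A ≋ B = ∀ i j → A i j ≡ B i j

Unimodular : ∀ {r} → Matrix r r → Set
Unimodular {r} U = Σ (Matrix r r) λ V → (U ⊗ V) ≋ idMatrix × (V ⊗ U) ≋ idMatrix

record IsHNF {r c} (H : Matrix r c) : Set where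
  field
    pivot      : Fin r → Maybe (Fin c)
    zeroRow    : ∀ i → pivot i ≡ nothing → ∀ j → H i j ≡ 0ℤ
    pivotPos   : ∀ i p → pivot i ≡ just p → 0ℤ ℤ.< H i p
    leading    : ∀ i p → pivot i ≡ just p → ∀ j → toℕ j < toℕ p → H i j ≡ 0ℤ
    echelon    : ∀ i i' p' → toℕ i < toℕ i' → pivot i' ≡ just p' →
                   Σ (Fin c) λ p → pivot i ≡ just p × toℕ p < toℕ p'
    reducedLo  : ∀ i p → pivot i ≡ just p → ∀ i' → toℕ i' < toℕ i → 0ℤ ℤ.≤ H i' p
    reducedHi  : ∀ i p → pivot i ≡ just p → ∀ i' → toℕ i' < toℕ i → H i' p ℤ.< H i p

HNFOf : ∀ {r c} → Matrix r c → Matrix r c → Set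
HNFOf {r} A H = IsHNF H × Σ (Matrix r r) λ U → Unimodular U × (U ⊗ A) ≋ H

DiagOneOneK : ∀ {r c} → Matrix r c → ℕ → Set
DiagOneOneK {r} {c} H k =
  ∀ (i : Fin r) (j : Fin c) → toℕ i ≡ toℕ j →
    H i j ≡ (if does (Data.Nat._≟_ (suc (toℕ j)) c) then + k else 1ℤ)

indicator : ∀ {m} → (Fin m → Bool) → Fin m → ℤ
indicator S j = if S j then 1ℤ else 0ℤ

closedNbhd : ∀ {m} → Graph m → Fin m → Fin m → Bool
closedNbhd G v w = does (v ≟ w) ∨ adj G v w

pairs : (m : ℕ) → List (Fin m × Fin m)
pairs m = concatMap (λ u → concatMap (λ v → if does (Data.Nat._<?_ (toℕ u) (toℕ v))
                                               then (u , v) ∷ [] else []) (allFin m))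
                    (allFin m)

-- rows of C_Γ: N[v] for all v, then N[u] ∩ N[v] for all pairs u ≠ v
raRows : ∀ {m} → Graph m → List (Fin m → ℤ)
raRows {m} G =
  map (λ v → indicator (closedNbhd G v)) (allFin m) ++
  map (λ { (u , v) → indicator (λ w → closedNbhd G u w ∧ closedNbhd G v w) }) (pairs m)

RAMatrix : ∀ {m} (G : Graph m) → Matrix (length (raRows G)) m
RAMatrix G i = lookup (raRows G) i

permuteCols : ∀ {r c} → Permutation′ c → Matrix r c → Matrix r c
permuteCols σ A i j = A i (σ ⟨$⟩ʳ j)

-- Γ is 1/k-RA (k ≥ 1)
IsRA : ∀ {m} → Graph m → ℕ → Set
IsRA {m} G k = 1 ≤ k × (∀ (σ : Permutation′ m) →
  Σ (Matrix (length (raRows G)) m) λ H →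
    HNFOf (permuteCols σ (RAMatrix G)) H × DiagOneOneK H k)

{-# OPTIONS --safe #-}
-- Give each vertex i of Cr(2n) the weight +1 and each i′ the weight -1, and
-- let weight x = ∑ᵤ ±x_u for x ∈ ℤ^{2n}. The graph is bipartite and contains the
-- 4-cycle 1 2′ 3 4′, so its girth is 4. Every row of C_Γ has weight -(n-2), 0 or
-- n-2, and the rows N[a] ∩ N[b′] = e_a + e_b′ (a ≠ b) together with N[2] ∩ N[3]
-- already generate L = { x : (n-2) ∣ weight x }, because modulo them every e_u is
-- congruent to ±e_1. So the rows of C_Γ span exactly L, and reordering the
-- columns only permutes the weights. For a ±1 weight vector, L has the Hermite
-- basis e_t + c_t e_last (t < last), (n-2) e_last with 0 ≤ c_t < n-2, of diagonal
-- (1, …, 1, n-2); padded with zero rows it is row-equivalent to C_Γ, since the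
-- rows of each matrix are integer combinations of the rows of the other.
module Submission where

open import Defs hiding (sym)
open import Data.Bool using (Bool; true; false; if_then_else_; _∧_; _∨_; not)
open import Data.Bool.Properties using (not-injective; not-involutive; not-¬; ∧-comm; ∧-idem; ∨-identityʳ)
open import Data.Empty using (⊥-elim)
open import Data.Fin using (Fin; zero; suc; toℕ; _≟_; _↑ˡ_; _↑ʳ_; inject≤; fromℕ<; fromℕ; splitAt; join)
import Data.Fin.Properties as Finₚ
open import Data.Fin.Permutation using (Permutation′; _⟨$⟩ʳ_; _⟨$⟩ˡ_; inverseˡ)
open import Data.Integer as ℤ using (ℤ; +_; 0ℤ; 1ℤ; -1ℤ; _+_; _-_; _*_; -_)
open import Data.Integer.Divisibility.Signed using (_∣_; divides; ∣m∣n⇒∣m+n; ∣m∣n⇒∣m-n; ∣n⇒∣m*n; ∣m+n∣n⇒∣m)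
open import Data.Integer.DivMod using (n%ℕd<d; a≡a%ℕn+[a/ℕn]*n)
import Data.Integer.Properties as ℤₚ
open import Data.Integer.Tactic.RingSolver using (solve-∀)
open import Data.List using (List; []; _∷_; _++_; map; length; lookup; allFin)
open import Data.List.Membership.Propositional using (_∈_; lose)
open import Data.List.Membership.Propositional.Properties using (∈-lookup; ∈-++⁻; ∈-map⁺; ∈-map⁻; ∈-allFin; ∈-concatMap⁺)
open import Data.List.Properties using (length-map; length-tabulate; length-++-≤ˡ)
open import Data.List.Relation.Unary.Any as Any using (here)
open import Data.List.Relation.Unary.Any.Properties using (lookup-index)
open import Data.Maybe using (Maybe; just; nothing)
open import Data.Nat as ℕ using (ℕ; zero; suc; _≤_; _∸_; z≤n; s≤s)
import Data.Nat.Properties as ℕₚ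
open import Data.Product using (Σ; _×_; _,_; proj₁; proj₂)
open import Data.Sum using (_⊎_; inj₁; inj₂; [_,_]′; reduce)
open import Function using (_∘_; case_of_)
open import Function.Definitions using (Injective)
open import Relation.Binary.PropositionalEquality
open import Relation.Nullary using (Dec; yes; no; does; ¬_)
open import Relation.Nullary.Decidable using (dec-true; dec-false)
import Algebra.Properties.CommutativeMonoid.Sum ℤₚ.+-0-commutativeMonoid as Sum

private
  variable
    k m n r c : ℕ

δ : Fin n → Fin n → ℤ
δ = idMatrix

𝟙 : Bool → ℤ
𝟙 b = if b then 1ℤ else 0ℤ

δ-refl : (i : Fin n) → δ i i ≡ 1ℤ
δ-refl i = cong 𝟙 (dec-true (i ≟ i) refl)

δ-≢ : {i j : Fin n} → ¬ i ≡ j → δ i j ≡ 0ℤ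
δ-≢ {i = i} {j} i≢j = cong 𝟙 (dec-false (i ≟ j) i≢j)

δ-comm : (i j : Fin n) → δ i j ≡ δ j i
δ-comm i j with i ≟ j | j ≟ i
... | yes _   | yes _   = refl
... | no  _   | no  _   = refl
... | yes i≡j | no  j≢i = ⊥-elim (j≢i (sym i≡j))
... | no  i≢j | yes j≡i = ⊥-elim (i≢j (sym j≡i))

∑-cong : {f g : Fin n → ℤ} → (∀ i → f i ≡ g i) → ∑ f ≡ ∑ g
∑-cong {zero}  f≗g = refl
∑-cong {suc n} f≗g = cong₂ _+_ (f≗g zero) (∑-cong (λ i → f≗g (suc i)))

∑-zero : (f : Fin n → ℤ) → (∀ i → f i ≡ 0ℤ) → ∑ f ≡ 0ℤ
∑-zero {zero}  f f≗0 = refl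
∑-zero {suc n} f f≗0 = cong₂ _+_ (f≗0 zero) (∑-zero (λ i → f (suc i)) (λ i → f≗0 (suc i)))

∑-distrib-+ : (f g : Fin n → ℤ) → ∑ (λ i → f i + g i) ≡ ∑ f + ∑ g
∑-distrib-+ {zero}  f g = refl
∑-distrib-+ {suc n} f g = begin
  f zero + g zero + ∑ (λ i → f (suc i) + g (suc i))
    ≡⟨ cong (_+_ (f zero + g zero)) (∑-distrib-+ (λ i → f (suc i)) (λ i → g (suc i))) ⟩
  f zero + g zero + (∑ (λ i → f (suc i)) + ∑ (λ i → g (suc i)))
    ≡⟨ interchange (f zero) (g zero) _ _ ⟩
  ∑ f + ∑ g ∎
  where
  open ≡-Reasoning
  interchange : ∀ a b x y → a + b + (x + y) ≡ a + x + (b + y)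
  interchange = solve-∀

∑-neg : (f : Fin n → ℤ) → ∑ (λ i → - f i) ≡ - ∑ f
∑-neg {zero}  f = refl
∑-neg {suc n} f =
  trans (cong (_+_ (- f zero)) (∑-neg (λ i → f (suc i)))) (sym (ℤₚ.neg-distrib-+ (f zero) _))

*-distribˡ-- : ∀ a b c → a * (b - c) ≡ a * b - a * c
*-distribˡ-- = solve-∀

∑-distrib-- : (f g : Fin n → ℤ) → ∑ (λ i → f i - g i) ≡ ∑ f - ∑ g
∑-distrib-- f g = trans (∑-distrib-+ f (λ i → - g i)) (cong (_+_ (∑ f)) (∑-neg g))

*-distribˡ-∑ : ∀ x (f : Fin n → ℤ) → x * ∑ f ≡ ∑ (λ i → x * f i)
*-distribˡ-∑ {zero}  x f = ℤₚ.*-zeroʳ x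
*-distribˡ-∑ {suc n} x f =
  trans (ℤₚ.*-distribˡ-+ x (f zero) _) (cong (_+_ (x * f zero)) (*-distribˡ-∑ x (λ i → f (suc i))))

*-distribʳ-∑ : ∀ x (f : Fin n → ℤ) → ∑ f * x ≡ ∑ (λ i → f i * x)
*-distribʳ-∑ x f =
  trans (ℤₚ.*-comm (∑ f) x) (trans (*-distribˡ-∑ x f) (∑-cong (λ i → ℤₚ.*-comm x (f i))))

∑-const : ∀ n x → ∑ {n} (λ _ → x) ≡ + n * x
∑-const zero    x = sym (ℤₚ.*-zeroˡ x)
∑-const (suc n) x = begin
  x + ∑ {n} (λ _ → x)   ≡⟨ cong (_+_ x) (∑-const n x) ⟩
  x + + n * x           ≡⟨ cong (_+ + n * x) (sym (ℤₚ.*-identityˡ x)) ⟩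
  1ℤ * x + + n * x      ≡⟨ sym (ℤₚ.*-distribʳ-+ x 1ℤ (+ n)) ⟩
  + suc n * x           ∎
  where open ≡-Reasoning

∑-comm : (f : Fin m → Fin n → ℤ) → ∑ (λ i → ∑ (λ j → f i j)) ≡ ∑ (λ j → ∑ (λ i → f i j))
∑-comm {zero}  f = sym (∑-zero (λ j → ∑ (λ i → f i j)) (λ _ → refl))
∑-comm {suc m} f =
  trans (cong (_+_ (∑ (f zero))) (∑-comm (λ i → f (suc i))))
        (sym (∑-distrib-+ (f zero) (λ j → ∑ (λ i → f (suc i) j))))

∑-δˡ : ∀ (a : Fin n) f → ∑ (λ i → δ a i * f i) ≡ f a
∑-δˡ zero    f = trans (cong₂ _+_ (ℤₚ.*-identityˡ (f zero)) (∑-zero (λ i → δ zero (suc i) * f (suc i)) (λ _ → refl)))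
                      (ℤₚ.+-identityʳ _)
∑-δˡ (suc a) f = trans (ℤₚ.+-identityˡ _) (∑-δˡ a (λ i → f (suc i)))

∑-δʳ : ∀ (a : Fin n) f → ∑ (λ i → f i * δ i a) ≡ f a
∑-δʳ a f =
  trans (∑-cong (λ i → trans (ℤₚ.*-comm (f i) (δ i a)) (cong (_* f i) (δ-comm i a)))) (∑-δˡ a f)

∑-↑ : ∀ m (f : Fin (m ℕ.+ n) → ℤ) → ∑ f ≡ ∑ (λ a → f (a ↑ˡ n)) + ∑ (λ b → f (m ↑ʳ b))
∑-↑ zero    f = sym (ℤₚ.+-identityˡ (∑ f))
∑-↑ (suc m) f =
  trans (cong (_+_ (f zero)) (∑-↑ m (λ i → f (suc i)))) (sym (ℤₚ.+-assoc (f zero) _ _))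

∑-permute : (σ : Permutation′ n) (f : Fin n → ℤ) → ∑ f ≡ ∑ (λ p → f (σ ⟨$⟩ʳ p))
∑-permute σ f = trans (∑≡sum f) (trans (Sum.∑-permute f σ) (sym (∑≡sum (λ p → f (σ ⟨$⟩ʳ p)))))
  where
  ∑≡sum : ∀ {n} (f : Fin n → ℤ) → ∑ f ≡ Sum.sum f
  ∑≡sum {zero}  f = refl
  ∑≡sum {suc n} f = cong (_+_ (f zero)) (∑≡sum (λ i → f (suc i)))

∑-inject≤ : (m≤n : m ℕ.≤ n) (f : Fin n → ℤ) → (∀ j → m ℕ.≤ toℕ j → f j ≡ 0ℤ) →
            ∑ f ≡ ∑ (λ t → f (inject≤ t m≤n))
∑-inject≤ {zero}  z≤n       f vanish = ∑-zero f (λ j → vanish j z≤n)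
∑-inject≤ {suc m} (s≤s m≤n) f vanish =
  cong (_+_ (f zero)) (∑-inject≤ m≤n (λ j → f (suc j)) (λ j m≤j → vanish (suc j) (s≤s m≤j)))

∑-∣ : ∀ {d} (f : Fin n → ℤ) → (∀ i → d ∣ f i) → d ∣ ∑ f
∑-∣ {zero}  f d∣f = divides 0ℤ refl
∑-∣ {suc n} f d∣f = ∣m∣n⇒∣m+n (d∣f zero) (∑-∣ (λ i → f (suc i)) (λ i → d∣f (suc i)))

𝟙-not : ∀ b → 𝟙 (not b) ≡ 1ℤ - 𝟙 b
𝟙-not true  = refl
𝟙-not false = refl

𝟙-∧ : ∀ b b′ → 𝟙 (b ∧ b′) ≡ 𝟙 b * 𝟙 b′
𝟙-∧ true  b′ = sym (ℤₚ.*-identityˡ (𝟙 b′))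
𝟙-∧ false b′ = refl

does-≟-injective : {f : Fin m → Fin n} → Injective _≡_ _≡_ f → ∀ a b → does (f a ≟ f b) ≡ does (a ≟ b)
does-≟-injective {f = f} f-inj a b with a ≟ b
... | yes refl = dec-true (f a ≟ f a) refl
... | no  a≢b  = dec-false (f a ≟ f b) (a≢b ∘ f-inj)

δ*[1-δ]≡δ : {a b : Fin n} → ¬ b ≡ a → ∀ x → δ a x * (1ℤ - δ b x) ≡ δ a x
δ*[1-δ]≡δ {a = a} {b} b≢a x with a ≟ x
... | yes refl rewrite δ-≢ b≢a = refl
... | no  _    = refl

∑-δ : (i : Fin n) → ∑ (δ i) ≡ 1ℤ
∑-δ i = trans (∑-cong (λ a → sym (ℤₚ.*-identityʳ (δ i a)))) (∑-δˡ i (λ _ → 1ℤ))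

∑-[1-δ] : (i : Fin n) → ∑ (λ a → 1ℤ - δ i a) ≡ + n - 1ℤ
∑-[1-δ] {n} i =
  trans (∑-distrib-- (λ _ → 1ℤ) (δ i)) (cong₂ _-_ (trans (∑-const n 1ℤ) (ℤₚ.*-identityʳ (+ n))) (∑-δ i))

∑-δ*[1-δ] : (i j : Fin n) → ∑ (λ a → δ i a * (1ℤ - δ j a)) ≡ 1ℤ - δ j i
∑-δ*[1-δ] i j = ∑-δˡ i (λ a → 1ℤ - δ j a)

∑-[1-δ]*δ : (i j : Fin n) → ∑ (λ a → (1ℤ - δ i a) * δ j a) ≡ 1ℤ - δ i j
∑-[1-δ]*δ i j = trans (∑-cong (λ a → ℤₚ.*-comm (1ℤ - δ i a) (δ j a))) (∑-δˡ j (λ a → 1ℤ - δ i a))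

∑-[1-δ]*[1-δ] : (i j : Fin n) → ∑ (λ a → (1ℤ - δ i a) * (1ℤ - δ j a)) ≡ + n - 1ℤ - (1ℤ - δ i j)
∑-[1-δ]*[1-δ] {n} i j = begin
  ∑ (λ a → (1ℤ - δ i a) * (1ℤ - δ j a))
    ≡⟨ ∑-cong (λ a → expand (δ i a) (δ j a)) ⟩
  ∑ (λ a → (1ℤ - δ i a) - δ j a * (1ℤ - δ i a))
    ≡⟨ ∑-distrib-- (λ a → 1ℤ - δ i a) (λ a → δ j a * (1ℤ - δ i a)) ⟩
  ∑ (λ a → 1ℤ - δ i a) - ∑ (λ a → δ j a * (1ℤ - δ i a))
    ≡⟨ cong₂ _-_ (∑-[1-δ] i) (∑-δ*[1-δ] j i) ⟩
  + n - 1ℤ - (1ℤ - δ i j) ∎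
  where
  open ≡-Reasoning
  expand : ∀ x y → (1ℤ - x) * (1ℤ - y) ≡ (1ℤ - x) - y * (1ℤ - x)
  expand = solve-∀

-- Row equivalence by block-triangular elementary operations

infixl 6 _⊕_

_⊕_ : Matrix r c → Matrix r c → Matrix r c
(A ⊕ B) i j = A i j + B i j

≋-refl : {A : Matrix r c} → A ≋ A
≋-refl i j = refl

≋-trans : {A B C : Matrix r c} → A ≋ B → B ≋ C → A ≋ C
≋-trans A≋B B≋C i j = trans (A≋B i j) (B≋C i j)

⊗-cong : {A A′ : Matrix r k} {B B′ : Matrix k c} → A ≋ A′ → B ≋ B′ → (A ⊗ B) ≋ (A′ ⊗ B′)
⊗-cong A≋A′ B≋B′ i j = ∑-cong (λ l → cong₂ _*_ (A≋A′ i l) (B≋B′ l j))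

⊗-assoc : (A : Matrix r k) (B : Matrix k m) (C : Matrix m c) → ((A ⊗ B) ⊗ C) ≋ (A ⊗ (B ⊗ C))
⊗-assoc A B C i j = begin
  ∑ (λ l → ∑ (λ p → A i p * B p l) * C l j)
    ≡⟨ ∑-cong (λ l → *-distribʳ-∑ (C l j) (λ p → A i p * B p l)) ⟩
  ∑ (λ l → ∑ (λ p → A i p * B p l * C l j))
    ≡⟨ ∑-comm (λ l p → A i p * B p l * C l j) ⟩
  ∑ (λ p → ∑ (λ l → A i p * B p l * C l j))
    ≡⟨ ∑-cong (λ p → ∑-cong (λ l → ℤₚ.*-assoc (A i p) (B p l) (C l j))) ⟩
  ∑ (λ p → ∑ (λ l → A i p * (B p l * C l j)))
    ≡⟨ ∑-cong (λ p → sym (*-distribˡ-∑ (A i p) (λ l → B p l * C l j))) ⟩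
  ∑ (λ p → A i p * ∑ (λ l → B p l * C l j)) ∎
  where open ≡-Reasoning

⊗-identityˡ : (A : Matrix r c) → (idMatrix ⊗ A) ≋ A
⊗-identityˡ A i j = ∑-δˡ i (λ l → A l j)

⊗-identityʳ : (A : Matrix r c) → (A ⊗ idMatrix) ≋ A
⊗-identityʳ A i j = ∑-δʳ j (A i)

⊗-distribˡ-⊕ : (A : Matrix r k) (B C : Matrix k c) → (A ⊗ (B ⊕ C)) ≋ ((A ⊗ B) ⊕ (A ⊗ C))
⊗-distribˡ-⊕ A B C i j =
  trans (∑-cong (λ l → ℤₚ.*-distribˡ-+ (A i l) (B l j) (C l j)))
        (∑-distrib-+ (λ l → A i l * B l j) (λ l → A i l * C l j))

⊗-distribʳ-⊕ : (A B : Matrix r k) (C : Matrix k c) → ((A ⊕ B) ⊗ C) ≋ ((A ⊗ C) ⊕ (B ⊗ C))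
⊗-distribʳ-⊕ A B C i j =
  trans (∑-cong (λ l → ℤₚ.*-distribʳ-+ (C l j) (A i l) (B i l)))
        (∑-distrib-+ (λ l → A i l * C l j) (λ l → B i l * C l j))

Unimodular-⊗ : {U V : Matrix r r} → Unimodular U → Unimodular V → Unimodular (U ⊗ V)
Unimodular-⊗ {U = U} {V} (U⁻¹ , UU⁻¹ , U⁻¹U) (V⁻¹ , VV⁻¹ , V⁻¹V) = V⁻¹ ⊗ U⁻¹ ,
  cancel U V V⁻¹ U⁻¹ VV⁻¹ UU⁻¹ , cancel V⁻¹ U⁻¹ U V U⁻¹U V⁻¹V
  where
  cancel : (P Q Q′ P′ : Matrix r r) → (Q ⊗ Q′) ≋ idMatrix → (P ⊗ P′) ≋ idMatrix →
           ((P ⊗ Q) ⊗ (Q′ ⊗ P′)) ≋ idMatrix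
  cancel P Q Q′ P′ QQ′ PP′ =
    ≋-trans (⊗-assoc P Q (Q′ ⊗ P′))
    (≋-trans (⊗-cong (≋-refl {A = P}) (λ i j → sym (⊗-assoc Q Q′ P′ i j)))
    (≋-trans (⊗-cong (≋-refl {A = P}) (⊗-cong QQ′ (≋-refl {A = P′})))
    (≋-trans (⊗-cong (≋-refl {A = P}) (⊗-identityˡ P′)) PP′)))

RowEquivalent : Matrix r c → Matrix r c → Set
RowEquivalent {r} A B = Σ (Matrix r r) λ U → Unimodular U × (U ⊗ A) ≋ B

RowEquivalent-trans : {A B C : Matrix r c} → RowEquivalent A B → RowEquivalent B C → RowEquivalent A C
RowEquivalent-trans {A = A} (U , U-unimodular , UA≋B) (V , V-unimodular , VB≋C) =
  V ⊗ U , Unimodular-⊗ V-unimodular U-unimodular ,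
  ≋-trans (⊗-assoc V U A) (≋-trans (⊗-cong (≋-refl {A = V}) UA≋B) VB≋C)

RowEquivalent-respʳ : {A B C : Matrix r c} → RowEquivalent A B → B ≋ C → RowEquivalent A C
RowEquivalent-respʳ (U , U-unimodular , UA≋B) B≋C = U , U-unimodular , ≋-trans UA≋B B≋C

-- Adding to the rows in S combinations of the rows outside S: the matrix of
-- such an operation squares to zero, so I + C is invertible with inverse I - C.
corner : (Fin r → Bool) → Matrix r r → Matrix r r
corner S D i j = if S i then (if S j then 0ℤ else D i j) else 0ℤ

corner-⊗-corner : ∀ S (D D′ : Matrix r r) → (corner S D ⊗ corner S D′) ≋ (λ _ _ → 0ℤ)
corner-⊗-corner S D D′ i j = ∑-zero _ vanish
  where
  vanish : ∀ l → corner S D i l * corner S D′ l j ≡ 0ℤ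
  vanish l with S i | S l
  ... | false | _     = refl
  ... | true  | true  = refl
  ... | true  | false = ℤₚ.*-zeroʳ (D i l)

corner-inverse : ∀ S (D D′ : Matrix r r) → (∀ i j → D′ i j ≡ - D i j) →
                 ((idMatrix ⊕ corner S D) ⊗ (idMatrix ⊕ corner S D′)) ≋ idMatrix
corner-inverse S D D′ D′≡-D i j = begin
  ((idMatrix ⊕ C) ⊗ (idMatrix ⊕ C′)) i j
    ≡⟨ ⊗-distribʳ-⊕ idMatrix C (idMatrix ⊕ C′) i j ⟩
  (idMatrix ⊗ (idMatrix ⊕ C′)) i j + (C ⊗ (idMatrix ⊕ C′)) i j
    ≡⟨ cong₂ _+_ (⊗-identityˡ (idMatrix ⊕ C′) i j) (⊗-distribˡ-⊕ C idMatrix C′ i j) ⟩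
  idMatrix i j + C′ i j + ((C ⊗ idMatrix) i j + (C ⊗ C′) i j)
    ≡⟨ cong₂ (λ x y → idMatrix i j + x + (y + (C ⊗ C′) i j)) C′≡-C (⊗-identityʳ C i j) ⟩
  idMatrix i j + - C i j + (C i j + (C ⊗ C′) i j)
    ≡⟨ cong (λ x → idMatrix i j + - C i j + (C i j + x)) (corner-⊗-corner S D D′ i j) ⟩
  idMatrix i j + - C i j + (C i j + 0ℤ)
    ≡⟨ cancel (idMatrix i j) (C i j) ⟩
  idMatrix i j ∎
  where
  open ≡-Reasoning
  C C′ : Matrix _ _
  C = corner S D
  C′ = corner S D′
  C′≡-C : C′ i j ≡ - C i j
  C′≡-C with S i | S j
  ... | false | _     = refl
  ... | true  | true  = refl
  ... | true  | false = D′≡-D i j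
  cancel : ∀ a x → a + - x + (x + 0ℤ) ≡ a
  cancel = solve-∀

addCornerRows : ∀ S (D : Matrix r r) (A : Matrix r c) → RowEquivalent A (A ⊕ (corner S D ⊗ A))
addCornerRows S D A = idMatrix ⊕ corner S D ,
  (idMatrix ⊕ corner S D⁻ , corner-inverse S D D⁻ (λ _ _ → refl) ,
   corner-inverse S D⁻ D (λ i j → sym (ℤₚ.neg-involutive (D i j)))) ,
  ≋-trans (⊗-distribʳ-⊕ idMatrix (corner S D) A) (λ i j → cong (_+ (corner S D ⊗ A) i j) (⊗-identityˡ A i j))
  where
  D⁻ : Matrix _ _
  D⁻ i j = - D i j

corner-row-inside : ∀ S D (A : Matrix r c) {i} → S i ≡ true → (∀ j → S j ≡ true → D i j ≡ 0ℤ) →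
                    ∀ w → (corner S D ⊗ A) i w ≡ ∑ (λ j → D i j * A j w)
corner-row-inside S D A {i} Si vanish w rewrite Si = ∑-cong term
  where
  term : ∀ j → (if S j then 0ℤ else D i j) * A j w ≡ D i j * A j w
  term j with S j in Sj
  ... | true  = cong (_* A j w) (sym (vanish j Sj))
  ... | false = refl

corner-row-outside : ∀ S D (A : Matrix r c) {i} → S i ≡ false → ∀ w → (corner S D ⊗ A) i w ≡ 0ℤ
corner-row-outside S D A {i} Si w rewrite Si = ∑-zero (λ j → 0ℤ * A j w) (λ _ → refl)

InSpan : Matrix r c → (Fin r → Bool) → (Fin c → ℤ) → Set
InSpan {r} M allowed v =
  Σ (Fin r → ℤ) λ a → (∀ j → allowed j ≡ false → a j ≡ 0ℤ) × (∀ w → v w ≡ ∑ (λ j → a j * M j w))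

module InSpanClosure (M : Matrix r c) (allowed : Fin r → Bool) where

  InSpan-resp : ∀ {u v} → (∀ w → u w ≡ v w) → InSpan M allowed u → InSpan M allowed v
  InSpan-resp u≗v (a , a-vanish , u≡aM) = a , a-vanish , λ w → trans (sym (u≗v w)) (u≡aM w)

  InSpan-row : ∀ j → allowed j ≡ true → InSpan M allowed (M j)
  InSpan-row j allowed-j = δ j , vanish , λ w → sym (∑-δˡ j (λ l → M l w))
    where
    vanish : ∀ l → allowed l ≡ false → δ j l ≡ 0ℤ
    vanish l allowed-l with j ≟ l
    ... | yes refl = case trans (sym allowed-j) allowed-l of λ ()
    ... | no _     = refl

  InSpan-zero : InSpan M allowed (λ _ → 0ℤ)
  InSpan-zero = (λ _ → 0ℤ) , (λ _ _ → refl) , λ w → sym (∑-zero (λ j → 0ℤ * M j w) (λ _ → refl))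

  InSpan-+ : ∀ {u v} → InSpan M allowed u → InSpan M allowed v → InSpan M allowed (λ w → u w + v w)
  InSpan-+ (a , a-vanish , u≡aM) (b , b-vanish , v≡bM) =
    (λ j → a j + b j) ,
    (λ j allowed-j → cong₂ _+_ (a-vanish j allowed-j) (b-vanish j allowed-j)) ,
    λ w → trans (cong₂ _+_ (u≡aM w) (v≡bM w))
                (trans (sym (∑-distrib-+ (λ j → a j * M j w) (λ j → b j * M j w)))
                       (∑-cong (λ j → sym (ℤₚ.*-distribʳ-+ (M j w) (a j) (b j)))))

  InSpan-* : ∀ x {v} → InSpan M allowed v → InSpan M allowed (λ w → x * v w)
  InSpan-* x (a , a-vanish , v≡aM) =
    (λ j → x * a j) ,
    (λ j allowed-j → trans (cong (x *_) (a-vanish j allowed-j)) (ℤₚ.*-zeroʳ x)) ,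
    λ w → trans (cong (x *_) (v≡aM w))
                (trans (*-distribˡ-∑ x (λ j → a j * M j w))
                       (∑-cong (λ j → sym (ℤₚ.*-assoc x (a j) (M j w)))))

  InSpan-- : ∀ {u v} → InSpan M allowed u → InSpan M allowed v → InSpan M allowed (λ w → u w - v w)
  InSpan-- {u} {v} u∈ v∈ =
    InSpan-resp (λ w → cong (_+_ (u w)) (ℤₚ.-1*i≡-i (v w))) (InSpan-+ u∈ (InSpan-* -1ℤ v∈))

  InSpan-∑ : (f : Fin n → Fin c → ℤ) → (∀ i → InSpan M allowed (f i)) →
             InSpan M allowed (λ w → ∑ (λ i → f i w))
  InSpan-∑ {zero}  f f∈ = InSpan-zero
  InSpan-∑ {suc n} f f∈ = InSpan-+ (f∈ zero) (InSpan-∑ (λ i → f (suc i)) (λ i → f∈ (suc i)))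

-- First replace each top row of A by the corresponding row of H (adding rows
-- outside the top), then clear the remaining rows (subtracting top rows, which
-- are now rows of H).
rowEquivalent-by-spans : (top : Fin r → Bool) (A H : Matrix r c) →
  (∀ i → top i ≡ false → ∀ w → H i w ≡ 0ℤ) →
  (∀ i → InSpan A (not ∘ top) (λ w → H i w - A i w)) →
  (∀ i → InSpan H top (A i)) →
  RowEquivalent A H
rowEquivalent-by-spans top A H H-bottom H-A∈ A∈ =
  RowEquivalent-trans (addCornerRows top a A)
    (RowEquivalent-respʳ (addCornerRows (not ∘ top) b⁻ A₁) A₂≋H)
  where
  a b b⁻ : Matrix _ _
  a i = proj₁ (H-A∈ i)
  b i = proj₁ (A∈ i)
  b⁻ i j = - b i j

  A₁ : Matrix _ _
  A₁ = A ⊕ (corner top a ⊗ A)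

  A₁-top : ∀ {i} → top i ≡ true → ∀ w → A₁ i w ≡ H i w
  A₁-top {i} top-i w = begin
    A i w + (corner top a ⊗ A) i w  ≡⟨ cong (_+_ (A i w)) (corner-row-inside top a A top-i a-vanish w) ⟩
    A i w + ∑ (λ j → a i j * A j w) ≡⟨ cong (_+_ (A i w)) (sym (proj₂ (proj₂ (H-A∈ i)) w)) ⟩
    A i w + (H i w - A i w)         ≡⟨ cancel (A i w) (H i w) ⟩
    H i w                           ∎
    where
    open ≡-Reasoning
    a-vanish : ∀ j → top j ≡ true → a i j ≡ 0ℤ
    a-vanish j top-j = proj₁ (proj₂ (H-A∈ i)) j (cong not top-j)
    cancel : ∀ x y → x + (y - x) ≡ y
    cancel = solve-∀

  A₁-bottom : ∀ {i} → top i ≡ false → ∀ w → A₁ i w ≡ A i w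
  A₁-bottom {i} top-i w =
    trans (cong (_+_ (A i w)) (corner-row-outside top a A top-i w)) (ℤₚ.+-identityʳ (A i w))

  bA₁≡bH : ∀ i w → ∑ (λ j → b i j * A₁ j w) ≡ ∑ (λ j → b i j * H j w)
  bA₁≡bH i w = ∑-cong term
    where
    term : ∀ j → b i j * A₁ j w ≡ b i j * H j w
    term j = split (top j) refl
      where
      split : ∀ t → top j ≡ t → b i j * A₁ j w ≡ b i j * H j w
      split true  top-j = cong (b i j *_) (A₁-top top-j w)
      split false top-j = trans (cong (_* A₁ j w) b-zero) (sym (cong (_* H j w) b-zero))
        where
        b-zero : b i j ≡ 0ℤ
        b-zero = proj₁ (proj₂ (A∈ i)) j top-j

  A₂≋H : (A₁ ⊕ (corner (not ∘ top) b⁻ ⊗ A₁)) ≋ H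
  A₂≋H i w = split (top i) refl
    where
    open ≡-Reasoning
    split : ∀ t → top i ≡ t → (A₁ ⊕ (corner (not ∘ top) b⁻ ⊗ A₁)) i w ≡ H i w
    split true top-i =
      trans (cong₂ _+_ (A₁-top top-i w) (corner-row-outside (not ∘ top) b⁻ A₁ (cong not top-i) w))
            (ℤₚ.+-identityʳ (H i w))
    split false top-i = begin
      A₁ i w + (corner (not ∘ top) b⁻ ⊗ A₁) i w
        ≡⟨ cong₂ _+_ (A₁-bottom top-i w) (corner-row-inside (not ∘ top) b⁻ A₁ (cong not top-i) b⁻-vanish w) ⟩
      A i w + ∑ (λ j → - b i j * A₁ j w)
        ≡⟨ cong (_+_ (A i w)) (trans (∑-cong (λ j → sym (ℤₚ.neg-distribˡ-* (b i j) (A₁ j w))))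
                                     (∑-neg (λ j → b i j * A₁ j w))) ⟩
      A i w - ∑ (λ j → b i j * A₁ j w)
        ≡⟨ cong (λ x → A i w - x) (trans (bA₁≡bH i w) (sym (proj₂ (proj₂ (A∈ i)) w))) ⟩
      A i w - A i w
        ≡⟨ ℤₚ.+-inverseʳ (A i w) ⟩
      0ℤ
        ≡⟨ sym (H-bottom i top-i w) ⟩
      H i w ∎
      where
      b⁻-vanish : ∀ j → not (top j) ≡ true → b⁻ i j ≡ 0ℤ
      b⁻-vanish j top-j = cong -_ (proj₁ (proj₂ (A∈ i)) j (not-injective top-j))

-- Triangular Hermite forms padded with zero rows

firstRows : ℕ → Fin r → Bool
firstRows m i = does (toℕ i ℕ.<? m)

≤⇒¬firstRow : ∀ {i : Fin r} → m ℕ.≤ toℕ i → firstRows m i ≡ false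
≤⇒¬firstRow m≤i = dec-false (_ ℕ.<? _) (ℕₚ.≤⇒≯ m≤i)

extend : {A : Set} → A → (Fin m → A) → Fin r → A
extend {m = m} z v i with toℕ i ℕ.<? m
... | yes i<m = v (fromℕ< i<m)
... | no  _   = z

extend-inject≤ : {A : Set} (z : A) (v : Fin m → A) (m≤r : m ℕ.≤ r) (t : Fin m) →
                 extend z v (inject≤ t m≤r) ≡ v t
extend-inject≤ {m = m} z v m≤r t with toℕ (inject≤ t m≤r) ℕ.<? m
... | yes t<m = cong v (Finₚ.toℕ-injective (trans (Finₚ.toℕ-fromℕ< t<m) (Finₚ.toℕ-inject≤ t m≤r)))
... | no  t≮m = ⊥-elim (t≮m (subst (ℕ._< m) (sym (Finₚ.toℕ-inject≤ t m≤r)) (Finₚ.toℕ<n t)))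

extend-outside : {A : Set} (z : A) (v : Fin m → A) {i : Fin r} → firstRows m i ≡ false → extend z v i ≡ z
extend-outside {m = m} z v {i} i-outside with toℕ i ℕ.<? m
... | yes i<m = case trans (sym (dec-true (toℕ i ℕ.<? m) i<m)) i-outside of λ ()
... | no  _   = refl

extend-all : {A : Set} (P : A → Set) {z : A} {v : Fin m → A} → P z → (∀ t → P (v t)) →
             ∀ (i : Fin r) → P (extend z v i)
extend-all {m = m} P Pz Pv i with toℕ i ℕ.<? m
... | yes i<m = Pv (fromℕ< i<m)
... | no  _   = Pz

extendRows : Matrix m c → Matrix r c
extendRows = extend (λ _ → 0ℤ)

∑-extendRows : (m≤r : m ℕ.≤ r) (y : Fin m → ℤ) (T : Matrix m c) →
               ∀ w → ∑ (λ j → extend {r = r} 0ℤ y j * extendRows T j w) ≡ ∑ (λ t → y t * T t w)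
∑-extendRows m≤r y T w =
  trans (∑-inject≤ m≤r _ vanish)
        (∑-cong (λ t → cong₂ _*_ (extend-inject≤ 0ℤ y m≤r t) (cong (λ row → row w) (extend-inject≤ _ T m≤r t))))
  where
  vanish : ∀ j → _ ℕ.≤ toℕ j → extend 0ℤ y j * extendRows T j w ≡ 0ℤ
  vanish j m≤j = cong (_* extendRows T j w) (extend-outside 0ℤ y (≤⇒¬firstRow m≤j))

extendRows-span : (m≤r : m ℕ.≤ r) (T : Matrix m c) {x : Fin c → ℤ} (y : Fin m → ℤ) →
                  (∀ w → x w ≡ ∑ (λ t → y t * T t w)) → InSpan (extendRows {r = r} T) (firstRows m) x
extendRows-span m≤r T y x≡yT =
  extend 0ℤ y , (λ j j-outside → extend-outside 0ℤ y j-outside) ,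
  λ w → trans (x≡yT w) (sym (∑-extendRows m≤r y T w))

extendRows-diagonal : (T : Matrix m m) (d : Fin m → ℤ) → (∀ t → T t t ≡ d t) →
                      ∀ (i : Fin r) j → toℕ i ≡ toℕ j → extendRows T i j ≡ d j
extendRows-diagonal {m = m} T d T-diag i j i≡j with toℕ i ℕ.<? m
... | yes i<m = trans (cong (λ t → T t j) (Finₚ.toℕ-injective (trans (Finₚ.toℕ-fromℕ< i<m) i≡j))) (T-diag j)
... | no  i≮m = ⊥-elim (i≮m (subst (ℕ._< m) (sym i≡j) (Finₚ.toℕ<n j)))

record IsTriangularHNF (T : Matrix m m) : Set where
  field
    lower-zero    : ∀ t w → toℕ w ℕ.< toℕ t → T t w ≡ 0ℤ
    diagonal-pos  : ∀ t → 0ℤ ℤ.< T t t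
    above-nonneg  : ∀ t p → toℕ t ℕ.< toℕ p → 0ℤ ℤ.≤ T t p
    above-reduced : ∀ t p → toℕ t ℕ.< toℕ p → T t p ℤ.< T p p

module _ {m r : ℕ} {T : Matrix m m} (T-hnf : IsTriangularHNF T) where
  open IsTriangularHNF T-hnf

  private
    H : Matrix r m
    H = extendRows T

    pivot : Fin r → Maybe (Fin m)
    pivot = extend nothing just

    zeroRow : ∀ i → pivot i ≡ nothing → ∀ j → H i j ≡ 0ℤ
    zeroRow i with toℕ i ℕ.<? m
    ... | no _ = λ _ _ → refl

    pivotPos : ∀ i p → pivot i ≡ just p → 0ℤ ℤ.< H i p
    pivotPos i p with toℕ i ℕ.<? m
    ... | yes _ = λ { refl → diagonal-pos p }

    leading : ∀ i p → pivot i ≡ just p → ∀ j → toℕ j ℕ.< toℕ p → H i j ≡ 0ℤ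
    leading i p with toℕ i ℕ.<? m
    ... | yes _ = λ { refl j j<p → lower-zero p j j<p }

    echelon : ∀ i i′ p′ → toℕ i ℕ.< toℕ i′ → pivot i′ ≡ just p′ →
              Σ (Fin m) λ p → pivot i ≡ just p × toℕ p ℕ.< toℕ p′
    echelon i i′ p′ i<i′ with toℕ i′ ℕ.<? m | toℕ i ℕ.<? m
    ... | yes i′<m | yes i<m = λ { refl → fromℕ< i<m , refl ,
            subst₂ ℕ._<_ (sym (Finₚ.toℕ-fromℕ< i<m)) (sym (Finₚ.toℕ-fromℕ< i′<m)) i<i′ }
    ... | yes i′<m | no  i≮m = λ _ → ⊥-elim (i≮m (ℕₚ.<-trans i<i′ i′<m))

    above : ∀ i p → pivot i ≡ just p → ∀ i′ → toℕ i′ ℕ.< toℕ i →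
            0ℤ ℤ.≤ H i′ p × H i′ p ℤ.< H i p
    above i p with toℕ i ℕ.<? m
    ... | yes i<m = λ { refl i′ i′<i → above′ i′ (subst (toℕ i′ ℕ.<_) (sym (Finₚ.toℕ-fromℕ< i<m)) i′<i) }
      where
      above′ : ∀ i′ → toℕ i′ ℕ.< toℕ (fromℕ< i<m) →
               0ℤ ℤ.≤ H i′ (fromℕ< i<m) × H i′ (fromℕ< i<m) ℤ.< T (fromℕ< i<m) (fromℕ< i<m)
      above′ i′ i′<p with toℕ i′ ℕ.<? m
      ... | yes i′<m = let lt = subst (ℕ._< _) (sym (Finₚ.toℕ-fromℕ< i′<m)) i′<p in
                       above-nonneg _ _ lt , above-reduced _ _ lt
      ... | no  _    = ℤ.+≤+ z≤n , diagonal-pos _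

  extendRows-isHNF : IsHNF H
  extendRows-isHNF = record
    { pivot     = pivot
    ; zeroRow   = zeroRow
    ; pivotPos  = pivotPos
    ; leading   = leading
    ; echelon   = echelon
    ; reducedLo = λ i p e i′ i′<i → proj₁ (above i p e i′ i′<i)
    ; reducedHi = λ i p e i′ i′<i → proj₂ (above i p e i′ i′<i)
    }

-- Lattices defined by a weighted congruence

InLattice : ℕ → (Fin c → ℤ) → (Fin c → ℤ) → Set
InLattice K ω x = + K ∣ ∑ (λ p → ω p * x p)

module _ {K : ℕ} {ω : Fin c → ℤ} where

  InLattice-resp : ∀ {x y} → (∀ w → x w ≡ y w) → InLattice K ω x → InLattice K ω y
  InLattice-resp x≗y = subst (+ K ∣_) (∑-cong (λ p → cong (ω p *_) (x≗y p)))

  InLattice-zero : InLattice K ω (λ _ → 0ℤ)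
  InLattice-zero = divides 0ℤ (∑-zero (λ p → ω p * 0ℤ) (λ p → ℤₚ.*-zeroʳ (ω p)))

  InLattice-- : ∀ {x y} → InLattice K ω x → InLattice K ω y → InLattice K ω (λ w → x w - y w)
  InLattice-- {x} {y} x∈ y∈ = subst (+ K ∣_) (sym ω·[x-y]) (∣m∣n⇒∣m-n x∈ y∈)
    where
    ω·[x-y] : ∑ (λ p → ω p * (x p - y p)) ≡ ∑ (λ p → ω p * x p) - ∑ (λ p → ω p * y p)
    ω·[x-y] = trans (∑-cong (λ p → *-distribˡ-- (ω p) (x p) (y p)))
                    (∑-distrib-- (λ p → ω p * x p) (λ p → ω p * y p))

1+[-1%ℕd]≡d : ∀ d .{{_ : ℕ.NonZero d}} → 1ℤ + + (-1ℤ ℤ.%ℕ d) ≡ + d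
1+[-1%ℕd]≡d (suc zero)    = refl
1+[-1%ℕd]≡d (suc (suc d)) = refl

-- The Hermite basis of { x : K ∣ ω · x } when ω_ℓ = ±1 at the last coordinate ℓ:
-- rows e_t + c_t e_ℓ with c_t ≡ -ω_ℓ ω_t (mod K) reduced into [0, K), so that
-- the last row is (1 + c_ℓ) e_ℓ = K e_ℓ.
module LatticeBasis {m} (K : ℕ) .{{_ : ℕ.NonZero K}} (ω : Fin (suc m) → ℤ)
                    (ωℓ²≡1 : ω (fromℕ m) * ω (fromℕ m) ≡ 1ℤ) where

  ℓ : Fin (suc m)
  ℓ = fromℕ m

  residue : Fin (suc m) → ℕ
  residue t = (- (ω ℓ * ω t)) ℤ.%ℕ K

  residue<K : ∀ t → residue t ℕ.< K
  residue<K t = n%ℕd<d (- (ω ℓ * ω t)) K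

  residue-congruent : ∀ t → + K ∣ + residue t + ω ℓ * ω t
  residue-congruent t = divides (- (a ℤ./ℕ K)) (begin
    + residue t + ω ℓ * ω t   ≡⟨ cong (_+_ (+ residue t)) (sym (ℤₚ.neg-involutive (ω ℓ * ω t))) ⟩
    + residue t - a           ≡⟨ cong (λ b → + residue t - b) (a≡a%ℕn+[a/ℕn]*n a K) ⟩
    + residue t - (+ residue t + a ℤ./ℕ K * + K)
                              ≡⟨ cancel (+ residue t) (a ℤ./ℕ K) (+ K) ⟩
    - (a ℤ./ℕ K) * + K        ∎)
    where
    open ≡-Reasoning
    a : ℤ
    a = - (ω ℓ * ω t)
    cancel : ∀ r q k → r - (r + q * k) ≡ - q * k
    cancel = solve-∀

  1+residue[ℓ] : 1ℤ + + residue ℓ ≡ + K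
  1+residue[ℓ] = trans (cong (λ u → 1ℤ + + ((- u) ℤ.%ℕ K)) ωℓ²≡1) (1+[-1%ℕd]≡d K)

  T : Matrix (suc m) (suc m)
  T t w = δ t w + δ w ℓ * + residue t

  T-column-ℓ : ∀ t → T t ℓ ≡ δ t ℓ + + residue t
  T-column-ℓ t =
    trans (cong (λ d → δ t ℓ + d * + residue t) (δ-refl ℓ)) (cong (_+_ (δ t ℓ)) (ℤₚ.*-identityˡ _))

  T-column-other : ∀ t {w} → ¬ w ≡ ℓ → T t w ≡ δ t w
  T-column-other t w≢ℓ = trans (cong (λ d → δ t _ + d * + residue t) (δ-≢ w≢ℓ)) (ℤₚ.+-identityʳ _)

  T-ℓℓ : T ℓ ℓ ≡ + K
  T-ℓℓ = trans (T-column-ℓ ℓ) (trans (cong (_+ + residue ℓ) (δ-refl ℓ)) 1+residue[ℓ])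

  last⇒≡ℓ : ∀ {t} → suc (toℕ t) ≡ suc m → t ≡ ℓ
  last⇒≡ℓ e = Finₚ.toℕ-injective (trans (ℕₚ.suc-injective e) (sym (Finₚ.toℕ-fromℕ m)))

  T-diagonal : ∀ t → T t t ≡ (if does (suc (toℕ t) ℕ.≟ suc m) then + K else 1ℤ)
  T-diagonal t = by-cases (t ≟ ℓ)
    where
    by-cases : Dec (t ≡ ℓ) → T t t ≡ (if does (suc (toℕ t) ℕ.≟ suc m) then + K else 1ℤ)
    by-cases (yes refl) = trans T-ℓℓ (cong (λ b → if b then + K else 1ℤ)
                      (sym (dec-true (suc (toℕ ℓ) ℕ.≟ suc m) (cong suc (Finₚ.toℕ-fromℕ m)))))
    by-cases (no t≢ℓ) = trans (trans (T-column-other t t≢ℓ) (δ-refl t)) (cong (λ b → if b then + K else 1ℤ)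
                      (sym (dec-false (suc (toℕ t) ℕ.≟ suc m) (t≢ℓ ∘ last⇒≡ℓ))))

  T-triangular : IsTriangularHNF T
  T-triangular = record
    { lower-zero    = lower-zero
    ; diagonal-pos  = diagonal-pos
    ; above-nonneg  = λ t p t<p → proj₁ (above t p t<p)
    ; above-reduced = λ t p t<p → proj₂ (above t p t<p)
    }
    where
    <ℓ : ∀ {w} → toℕ w ℕ.< m → ¬ w ≡ ℓ
    <ℓ {w} w<m = Finₚ.<⇒≢ (subst (toℕ w ℕ.<_) (sym (Finₚ.toℕ-fromℕ m)) w<m)

    lower-zero : ∀ t w → toℕ w ℕ.< toℕ t → T t w ≡ 0ℤ
    lower-zero t w w<t =
      trans (T-column-other t (<ℓ (ℕₚ.<-≤-trans w<t (ℕₚ.≤-pred (Finₚ.toℕ<n t)))))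
            (δ-≢ (Finₚ.<⇒≢ w<t ∘ sym))

    diagonal-pos : ∀ t → 0ℤ ℤ.< T t t
    diagonal-pos t = subst (0ℤ ℤ.<_) (sym (T-diagonal t)) (positive _)
      where
      positive : ∀ b → 0ℤ ℤ.< (if b then + K else 1ℤ)
      positive true  = ℤ.+<+ (ℕ.>-nonZero⁻¹ K)
      positive false = ℤ.+<+ (s≤s z≤n)

    above : ∀ t p → toℕ t ℕ.< toℕ p → 0ℤ ℤ.≤ T t p × T t p ℤ.< T p p
    above t p t<p = by-cases (p ≟ ℓ)
      where
      by-cases : Dec (p ≡ ℓ) → 0ℤ ℤ.≤ T t p × T t p ℤ.< T p p
      by-cases (yes refl) rewrite T-column-ℓ t | δ-≢ (Finₚ.<⇒≢ t<p) | T-ℓℓ =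
        ℤ.+≤+ z≤n , ℤ.+<+ (residue<K t)
      by-cases (no p≢ℓ) rewrite T-column-other t p≢ℓ | T-column-other p p≢ℓ | δ-≢ (Finₚ.<⇒≢ t<p) | δ-refl p =
        ℤ.+≤+ z≤n , ℤ.+<+ (s≤s z≤n)

  ω·T : ∀ t → ∑ (λ w → ω w * T t w) ≡ ω t + ω ℓ * + residue t
  ω·T t = begin
    ∑ (λ w → ω w * T t w)
      ≡⟨ ∑-cong (λ w → trans (cong (λ d → ω w * (d + δ w ℓ * + residue t)) (δ-comm t w))
                             (expand (ω w) (δ w t) (δ w ℓ) (+ residue t))) ⟩
    ∑ (λ w → ω w * δ w t + ω w * + residue t * δ w ℓ)
      ≡⟨ ∑-distrib-+ (λ w → ω w * δ w t) (λ w → ω w * + residue t * δ w ℓ) ⟩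
    ∑ (λ w → ω w * δ w t) + ∑ (λ w → ω w * + residue t * δ w ℓ)
      ≡⟨ cong₂ _+_ (∑-δʳ t ω) (∑-δʳ ℓ (λ w → ω w * + residue t)) ⟩
    ω t + ω ℓ * + residue t ∎
    where
    open ≡-Reasoning
    expand : ∀ o d e r → o * (d + e * r) ≡ o * d + o * r * e
    expand = solve-∀

  T-inLattice : ∀ t → InLattice K ω (T t)
  T-inLattice t = subst (+ K ∣_) (sym (trans (ω·T t) (sym ω[r+ωω]≡))) (∣n⇒∣m*n (ω ℓ) (residue-congruent t))
    where
    ω[r+ωω]≡ : ω ℓ * (+ residue t + ω ℓ * ω t) ≡ ω t + ω ℓ * + residue t
    ω[r+ωω]≡ = begin
      ω ℓ * (+ residue t + ω ℓ * ω t)          ≡⟨ expand (ω ℓ) (+ residue t) (ω t) ⟩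
      ω ℓ * ω ℓ * ω t + ω ℓ * + residue t      ≡⟨ cong (λ u → u * ω t + ω ℓ * + residue t) ωℓ²≡1 ⟩
      1ℤ * ω t + ω ℓ * + residue t             ≡⟨ cong (_+ ω ℓ * + residue t) (ℤₚ.*-identityˡ (ω t)) ⟩
      ω t + ω ℓ * + residue t                  ∎
      where
      open ≡-Reasoning
      expand : ∀ o r u → o * (r + o * u) ≡ o * o * u + o * r
      expand = solve-∀

  -- x = y T with y = x - s e_ℓ, where s K = ∑ₜ x_t c_t; the congruences
  -- c_t ≡ -ω_ℓ ω_t make that sum divisible by K.
  inLattice⇒T-combination : ∀ x → InLattice K ω x →
                            Σ (Fin (suc m) → ℤ) λ y → ∀ w → x w ≡ ∑ (λ t → y t * T t w)
  inLattice⇒T-combination x x∈ = y , x≡yT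
    where
    S : ℤ
    S = ∑ (λ t → x t * + residue t)

    K∣S : + K ∣ S
    K∣S = ∣m+n∣n⇒∣m (subst (+ K ∣_) split (∑-∣ _ (λ t → ∣n⇒∣m*n (x t) (residue-congruent t))))
                     (∣n⇒∣m*n (ω ℓ) x∈)
      where
      split : ∑ (λ t → x t * (+ residue t + ω ℓ * ω t)) ≡ S + ω ℓ * ∑ (λ t → ω t * x t)
      split = trans (∑-cong (λ t → expand (x t) (+ residue t) (ω ℓ) (ω t)))
                    (trans (∑-distrib-+ (λ t → x t * + residue t) (λ t → ω ℓ * (ω t * x t)))
                           (cong (_+_ S) (sym (*-distribˡ-∑ (ω ℓ) (λ t → ω t * x t)))))
        where
        expand : ∀ a r o u → a * (r + o * u) ≡ a * r + o * (u * a)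
        expand = solve-∀

    s : ℤ
    s = _∣_.quotient K∣S

    y : Fin (suc m) → ℤ
    y t = x t - s * δ t ℓ

    y·c : ∑ (λ t → y t * + residue t) ≡ S - s * + residue ℓ
    y·c = begin
      ∑ (λ t → y t * + residue t)
        ≡⟨ ∑-cong (λ t → expand (x t) s (δ t ℓ) (+ residue t)) ⟩
      ∑ (λ t → x t * + residue t - s * + residue t * δ t ℓ)
        ≡⟨ ∑-distrib-- (λ t → x t * + residue t) (λ t → s * + residue t * δ t ℓ) ⟩
      S - ∑ (λ t → s * + residue t * δ t ℓ)
        ≡⟨ cong (_-_ S) (∑-δʳ ℓ (λ t → s * + residue t)) ⟩
      S - s * + residue ℓ ∎
      where
      open ≡-Reasoning
      expand : ∀ a b d r → (a - b * d) * r ≡ a * r - b * r * d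
      expand = solve-∀

    x≡yT : ∀ w → x w ≡ ∑ (λ t → y t * T t w)
    x≡yT w = sym (begin
      ∑ (λ t → y t * T t w)
        ≡⟨ ∑-cong (λ t → expand (y t) (δ t w) (δ w ℓ) (+ residue t)) ⟩
      ∑ (λ t → y t * δ t w + δ w ℓ * (y t * + residue t))
        ≡⟨ ∑-distrib-+ (λ t → y t * δ t w) (λ t → δ w ℓ * (y t * + residue t)) ⟩
      ∑ (λ t → y t * δ t w) + ∑ (λ t → δ w ℓ * (y t * + residue t))
        ≡⟨ cong₂ _+_ (∑-δʳ w y) (sym (*-distribˡ-∑ (δ w ℓ) (λ t → y t * + residue t))) ⟩
      y w + δ w ℓ * ∑ (λ t → y t * + residue t)
        ≡⟨ cong (λ u → y w + δ w ℓ * u) (trans y·c (cong (_- s * + residue ℓ) (_∣_.equality K∣S))) ⟩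
      x w - s * δ w ℓ + δ w ℓ * (s * + K - s * + residue ℓ)
        ≡⟨ cong (λ k → x w - s * δ w ℓ + δ w ℓ * (s * k - s * + residue ℓ)) (sym 1+residue[ℓ]) ⟩
      x w - s * δ w ℓ + δ w ℓ * (s * (1ℤ + + residue ℓ) - s * + residue ℓ)
        ≡⟨ cancel (x w) s (δ w ℓ) (+ residue ℓ) ⟩
      x w ∎)
      where
      open ≡-Reasoning
      expand : ∀ a d e r → a * (d + e * r) ≡ a * d + e * (a * r)
      expand = solve-∀
      cancel : ∀ a s d r → a - s * d + d * (s * (1ℤ + r) - s * r) ≡ a
      cancel = solve-∀

hermiteForm-of-lattice : {R m : ℕ} (A : Matrix R (suc m)) → suc m ℕ.≤ R →
  (K : ℕ) .{{_ : ℕ.NonZero K}} (ω : Fin (suc m) → ℤ) → ω (fromℕ m) * ω (fromℕ m) ≡ 1ℤ →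
  (∀ i → InLattice K ω (A i)) →
  (∀ x → InLattice K ω x → InSpan A (not ∘ firstRows (suc m)) x) →
  Σ (Matrix R (suc m)) λ H → HNFOf A H × DiagOneOneK H K
hermiteForm-of-lattice {m = m} A m<R K ω ωℓ²≡1 A∈ spans =
  H , (extendRows-isHNF T-triangular , rowEquivalent-by-spans (firstRows (suc m)) A H H-bottom H-A∈ A∈H) ,
  extendRows-diagonal T _ T-diagonal
  where
  open LatticeBasis K ω ωℓ²≡1

  H : Matrix _ (suc m)
  H = extendRows T

  H-bottom : ∀ i → firstRows (suc m) i ≡ false → ∀ w → H i w ≡ 0ℤ
  H-bottom i i-bottom w = cong (λ row → row w) (extend-outside _ T {i} i-bottom)

  H-A∈ : ∀ i → InSpan A (not ∘ firstRows (suc m)) (λ w → H i w - A i w)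
  H-A∈ i = spans _ (InLattice-- {K = K} {ω} {H i} {A i}
                      (extend-all (InLattice K ω) (InLattice-zero {K = K} {ω}) T-inLattice i) (A∈ i))

  A∈H : ∀ i → InSpan H (firstRows (suc m)) (A i)
  A∈H i = let (y , A≡yT) = inLattice⇒T-combination (A i) (A∈ i) in extendRows-span m<R T y A≡yT

module _ {K : ℕ} {ω : Fin n → ℤ} (σ : Permutation′ n) where

  InLattice-permute : ∀ {x} → InLattice K ω x → InLattice K (ω ∘ (σ ⟨$⟩ʳ_)) (x ∘ (σ ⟨$⟩ʳ_))
  InLattice-permute {x} = subst (+ K ∣_) (∑-permute σ (λ u → ω u * x u))

  InLattice-unpermute : ∀ {x} → InLattice K (ω ∘ (σ ⟨$⟩ʳ_)) x → InLattice K ω (x ∘ (σ ⟨$⟩ˡ_))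
  InLattice-unpermute {x} = subst (+ K ∣_) (sym (trans (∑-permute σ (λ u → ω u * x (σ ⟨$⟩ˡ u)))
    (∑-cong (λ p → cong (λ q → ω (σ ⟨$⟩ʳ p) * x q) (inverseˡ σ)))))

-- A column permutation σ carries { x : K ∣ ω · x } to { x : K ∣ (ω ∘ σ) · x },
-- and ω ∘ σ is again a sign vector.
isRA-of-lattice : (G : Graph (suc m)) (K : ℕ) .{{_ : ℕ.NonZero K}} (ω : Fin (suc m) → ℤ) →
  (∀ u → ω u * ω u ≡ 1ℤ) → suc m ℕ.≤ length (raRows G) →
  (∀ i → InLattice K ω (RAMatrix G i)) →
  (∀ x → InLattice K ω x → InSpan (RAMatrix G) (not ∘ firstRows (suc m)) x) →
  IsRA G K
isRA-of-lattice G K ω ω²≡1 m<R rows∈ spans = ℕ.>-nonZero⁻¹ K , λ σ →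
  hermiteForm-of-lattice (permuteCols σ (RAMatrix G)) m<R K (ω ∘ (σ ⟨$⟩ʳ_)) (ω²≡1 _)
    (λ i → InLattice-permute {K = K} {ω} σ {RAMatrix G i} (rows∈ i)) (spans-permuted σ)
  where
  spans-permuted : ∀ σ x → InLattice K (ω ∘ (σ ⟨$⟩ʳ_)) x →
                   InSpan (permuteCols σ (RAMatrix G)) (not ∘ firstRows (suc _)) x
  spans-permuted σ x x∈ =
    let (a , a-vanish , x≡aA) = spans (x ∘ (σ ⟨$⟩ˡ_)) (InLattice-unpermute {K = K} {ω} σ {x} x∈) in
    a , a-vanish , λ w → trans (cong x (sym (inverseˡ σ))) (x≡aA (σ ⟨$⟩ʳ w))

lookup-++-index : {A : Set} (xs ys : List A) {y : A} → y ∈ ys →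
  Σ (Fin (length (xs ++ ys))) λ j → length xs ℕ.≤ toℕ j × lookup (xs ++ ys) j ≡ y
lookup-++-index []       ys y∈ys = Any.index y∈ys , z≤n , sym (lookup-index y∈ys)
lookup-++-index (x ∷ xs) ys y∈ys =
  let (j , xs≤j , eq) = lookup-++-index xs ys y∈ys in suc j , s≤s xs≤j , eq

pair∈pairs : {u v : Fin m} → toℕ u ℕ.< toℕ v → (u , v) ∈ pairs m
pair∈pairs {u = u} {v} u<v =
  ∈-concatMap⁺ _ (lose (∈-allFin u) (∈-concatMap⁺ _ (lose (∈-allFin v) singleton)))
  where
  singleton : (u , v) ∈ (if does (toℕ u ℕ.<? toℕ v) then (u , v) ∷ [] else [])
  singleton rewrite dec-true (toℕ u ℕ.<? toℕ v) u<v = here refl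

module _ (G : Graph m) where

  private
    nbhdRows : List (Fin m → ℤ)
    nbhdRows = map (λ v → indicator (closedNbhd G v)) (allFin m)

    #nbhdRows : length nbhdRows ≡ m
    #nbhdRows = trans (length-map _ (allFin m)) (length-tabulate (λ i → i))

  m≤#raRows : m ℕ.≤ length (raRows G)
  m≤#raRows = subst (ℕ._≤ length (raRows G)) #nbhdRows (length-++-≤ˡ nbhdRows)

  RAMatrix-rows : (P : (Fin m → ℤ) → Set) →
    (∀ v → P (indicator (closedNbhd G v))) →
    (∀ u v → P (indicator (λ w → closedNbhd G u w ∧ closedNbhd G v w))) →
    ∀ i → P (RAMatrix G i)
  RAMatrix-rows P P-nbhd P-pair i with ∈-++⁻ nbhdRows (∈-lookup {xs = raRows G} i)
  ... | inj₁ ∈nbhd = let (v , _ , eq) = ∈-map⁻ _ ∈nbhd in subst P (sym eq) (P-nbhd v)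
  ... | inj₂ ∈pair = let ((u , v) , _ , eq) = ∈-map⁻ _ ∈pair in subst P (sym eq) (P-pair u v)

  RAMatrix-pairRow : ∀ {u v} → toℕ u ℕ.< toℕ v →
    Σ (Fin (length (raRows G))) λ j →
      m ℕ.≤ toℕ j × RAMatrix G j ≡ indicator (λ w → closedNbhd G u w ∧ closedNbhd G v w)
  RAMatrix-pairRow u<v =
    let (j , nbhd≤j , eq) = lookup-++-index nbhdRows _ (∈-map⁺ _ (pair∈pairs u<v)) in
    j , subst (ℕ._≤ toℕ j) #nbhdRows nbhd≤j , eq

-- Girth

bipartite⇒¬triangle : {G : Graph m} (colour : Fin m → Bool) →
                      (∀ u v → adj G u v ≡ true → colour u ≡ not (colour v)) → ¬ HasCycle G 3
bipartite⇒¬triangle colour proper (_ , f , _ , f-adj) = not-¬ refl γ₀≡not-γ₀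
  where
  γ : Fin 3 → Bool
  γ = colour ∘ f
  γ₀≡not-γ₀ : γ zero ≡ not (γ zero)
  γ₀≡not-γ₀ = begin
    γ zero                         ≡⟨ proper _ _ (f-adj zero (suc zero) (inj₁ refl)) ⟩
    not (γ (suc zero))             ≡⟨ cong not (proper _ _ (f-adj (suc zero) (suc (suc zero)) (inj₁ refl))) ⟩
    not (not (γ (suc (suc zero)))) ≡⟨ not-involutive _ ⟩
    γ (suc (suc zero))             ≡⟨ proper _ _ (f-adj (suc (suc zero)) zero (inj₂ (refl , refl))) ⟩
    not (γ zero)                   ∎
    where open ≡-Reasoning

hasGirth-4 : {G : Graph m} → HasCycle G 4 → ¬ HasCycle G 3 → HasGirth G 4
hasGirth-4 {G = G} C₄ ¬C₃ =
  C₄ , λ k C → ℕₚ.≤∧≢⇒< (proj₁ C) (λ 3≡k → ¬C₃ (subst (HasCycle G) (sym 3≡k) C))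

-- The crown graph

module CrownGraph (n : ℕ) where

  G : Graph (n ℕ.+ n)
  G = Crown n

  Vertex : Set
  Vertex = Fin (n ℕ.+ n)

  left right : Fin n → Vertex
  left a  = a ↑ˡ n
  right b = n ↑ʳ b

  data Side : Vertex → Set where
    is-left  : ∀ a → Side (left a)
    is-right : ∀ b → Side (right b)

  side : ∀ u → Side u
  side u = subst Side (Finₚ.join-splitAt n n u) (from (splitAt n u))
    where
    from : ∀ s → Side (join n n s)
    from (inj₁ a) = is-left a
    from (inj₂ b) = is-right b

  isLeft : Vertex → Bool
  isLeft u = [ (λ _ → true) , (λ _ → false) ]′ (splitAt n u)

  isLeft-left : ∀ a → isLeft (left a) ≡ true
  isLeft-left a = cong [ (λ _ → true) , (λ _ → false) ]′ (Finₚ.splitAt-↑ˡ n a n)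

  isLeft-right : ∀ b → isLeft (right b) ≡ false
  isLeft-right b = cong [ (λ _ → true) , (λ _ → false) ]′ (Finₚ.splitAt-↑ʳ n n b)

  index : Vertex → Fin n
  index u = reduce (splitAt n u)

  index-left : ∀ a → index (left a) ≡ a
  index-left a = cong reduce (Finₚ.splitAt-↑ˡ n a n)

  index-right : ∀ b → index (right b) ≡ b
  index-right b = cong reduce (Finₚ.splitAt-↑ʳ n n b)

  left≢right : ∀ a b → ¬ left a ≡ right b
  left≢right a b eq = case trans (sym (isLeft-left a)) (trans (cong isLeft eq) (isLeft-right b)) of λ ()

  does-left-left : ∀ a b → does (left a ≟ left b) ≡ does (a ≟ b)
  does-left-left = does-≟-injective (Finₚ.↑ˡ-injective n _ _)

  does-right-right : ∀ a b → does (right a ≟ right b) ≡ does (a ≟ b)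
  does-right-right = does-≟-injective (Finₚ.↑ʳ-injective n _ _)

  does-left-right : ∀ a b → does (left a ≟ right b) ≡ false
  does-left-right a b = dec-false (left a ≟ right b) (left≢right a b)

  does-right-left : ∀ a b → does (right b ≟ left a) ≡ false
  does-right-left a b = dec-false (right b ≟ left a) (left≢right a b ∘ sym)

  adj-left-left : ∀ a b → adj G (left a) (left b) ≡ false
  adj-left-left a b rewrite Finₚ.splitAt-↑ˡ n a n | Finₚ.splitAt-↑ˡ n b n = refl

  adj-left-right : ∀ a b → adj G (left a) (right b) ≡ not (does (a ≟ b))
  adj-left-right a b rewrite Finₚ.splitAt-↑ˡ n a n | Finₚ.splitAt-↑ʳ n n b = refl

  adj-right-left : ∀ a b → adj G (right b) (left a) ≡ not (does (a ≟ b))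
  adj-right-left a b rewrite Finₚ.splitAt-↑ʳ n n b | Finₚ.splitAt-↑ˡ n a n = refl

  adj-right-right : ∀ a b → adj G (right a) (right b) ≡ false
  adj-right-right a b rewrite Finₚ.splitAt-↑ʳ n n a | Finₚ.splitAt-↑ʳ n n b = refl

  N[_] : Vertex → Vertex → ℤ
  N[ u ] w = 𝟙 (closedNbhd G u w)

  N-left-left : ∀ i a → N[ left i ] (left a) ≡ δ i a
  N-left-left i a = cong 𝟙 (trans (cong₂ _∨_ (does-left-left i a) (adj-left-left i a)) (∨-identityʳ _))

  N-left-right : ∀ i b → N[ left i ] (right b) ≡ 1ℤ - δ i b
  N-left-right i b = trans (cong 𝟙 (cong₂ _∨_ (does-left-right i b) (adj-left-right i b))) (𝟙-not _)

  N-right-left : ∀ i a → N[ right i ] (left a) ≡ 1ℤ - δ i a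
  N-right-left i a = trans (cong 𝟙 (cong₂ _∨_ (does-right-left a i) (adj-right-left a i)))
                           (trans (𝟙-not _) (cong (_-_ 1ℤ) (δ-comm a i)))

  N-right-right : ∀ i b → N[ right i ] (right b) ≡ δ i b
  N-right-right i b = cong 𝟙 (trans (cong₂ _∨_ (does-right-right i b) (adj-right-right i b)) (∨-identityʳ _))

  sign : Vertex → ℤ
  sign u = if isLeft u then 1ℤ else -1ℤ

  sign-left : ∀ a → sign (left a) ≡ 1ℤ
  sign-left a = cong (λ b → if b then 1ℤ else -1ℤ) (isLeft-left a)

  sign-right : ∀ b → sign (right b) ≡ -1ℤ
  sign-right b = cong (λ c → if c then 1ℤ else -1ℤ) (isLeft-right b)

  sign² : ∀ u → sign u * sign u ≡ 1ℤ
  sign² u with isLeft u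
  ... | true  = refl
  ... | false = refl

  weight : (Vertex → ℤ) → ℤ
  weight x = ∑ (λ u → sign u * x u)

  weight-split : ∀ x → weight x ≡ ∑ (λ a → x (left a)) - ∑ (λ b → x (right b))
  weight-split x = trans (∑-↑ n (λ u → sign u * x u)) (cong₂ _+_
    (∑-cong (λ a → trans (cong (_* x (left a)) (sign-left a)) (ℤₚ.*-identityˡ (x (left a)))))
    (trans (∑-cong (λ b → trans (cong (_* x (right b)) (sign-right b)) (ℤₚ.-1*i≡-i (x (right b)))))
           (∑-neg (λ b → x (right b)))))

  pairRow : Vertex → Vertex → Vertex → ℤ
  pairRow u v w = 𝟙 (closedNbhd G u w ∧ closedNbhd G v w)

  pairRow-comm : ∀ u v w → pairRow u v w ≡ pairRow v u w
  pairRow-comm u v w = cong 𝟙 (∧-comm (closedNbhd G u w) _)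

  weight-pairRow : ∀ u v → weight (pairRow u v) ≡
    ∑ (λ a → N[ u ] (left a) * N[ v ] (left a)) - ∑ (λ b → N[ u ] (right b) * N[ v ] (right b))
  weight-pairRow u v = trans (weight-split (pairRow u v))
    (cong₂ _-_ (∑-cong (λ a → 𝟙-∧ (closedNbhd G u (left a)) _))
               (∑-cong (λ b → 𝟙-∧ (closedNbhd G u (right b)) _)))

  weight-left-left : ∀ i j → weight (pairRow (left i) (left j)) ≡ 1ℤ + 1ℤ - + n
  weight-left-left i j = begin
    weight (pairRow (left i) (left j))
      ≡⟨ weight-pairRow (left i) (left j) ⟩
    ∑ (λ a → N[ left i ] (left a) * N[ left j ] (left a)) - ∑ (λ b → N[ left i ] (right b) * N[ left j ] (right b))
      ≡⟨ cong₂ _-_ (∑-cong (λ a → cong₂ _*_ (N-left-left i a) (N-left-left j a)))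
                   (∑-cong (λ b → cong₂ _*_ (N-left-right i b) (N-left-right j b))) ⟩
    ∑ (λ a → δ i a * δ j a) - ∑ (λ b → (1ℤ - δ i b) * (1ℤ - δ j b))
      ≡⟨ cong₂ _-_ (∑-δˡ i (δ j)) (∑-[1-δ]*[1-δ] i j) ⟩
    δ j i - (+ n - 1ℤ - (1ℤ - δ i j))
      ≡⟨ cong (λ d → δ j i - (+ n - 1ℤ - (1ℤ - d))) (δ-comm i j) ⟩
    δ j i - (+ n - 1ℤ - (1ℤ - δ j i))
      ≡⟨ simplify (+ n) (δ j i) ⟩
    1ℤ + 1ℤ - + n ∎
    where
    open ≡-Reasoning
    simplify : ∀ k d → d - (k - 1ℤ - (1ℤ - d)) ≡ 1ℤ + 1ℤ - k
    simplify = solve-∀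

  weight-left-right : ∀ i j → weight (pairRow (left i) (right j)) ≡ 0ℤ
  weight-left-right i j = begin
    weight (pairRow (left i) (right j))
      ≡⟨ weight-pairRow (left i) (right j) ⟩
    ∑ (λ a → N[ left i ] (left a) * N[ right j ] (left a)) - ∑ (λ b → N[ left i ] (right b) * N[ right j ] (right b))
      ≡⟨ cong₂ _-_ (∑-cong (λ a → cong₂ _*_ (N-left-left i a) (N-right-left j a)))
                   (∑-cong (λ b → cong₂ _*_ (N-left-right i b) (N-right-right j b))) ⟩
    ∑ (λ a → δ i a * (1ℤ - δ j a)) - ∑ (λ b → (1ℤ - δ i b) * δ j b)
      ≡⟨ cong₂ _-_ (∑-δ*[1-δ] i j) (∑-[1-δ]*δ i j) ⟩
    (1ℤ - δ j i) - (1ℤ - δ i j)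
      ≡⟨ cong (λ d → (1ℤ - δ j i) - (1ℤ - d)) (δ-comm i j) ⟩
    (1ℤ - δ j i) - (1ℤ - δ j i)
      ≡⟨ ℤₚ.+-inverseʳ (1ℤ - δ j i) ⟩
    0ℤ ∎
    where open ≡-Reasoning

  weight-right-right : ∀ i j → weight (pairRow (right i) (right j)) ≡ + n - 1ℤ - 1ℤ
  weight-right-right i j = begin
    weight (pairRow (right i) (right j))
      ≡⟨ weight-pairRow (right i) (right j) ⟩
    ∑ (λ a → N[ right i ] (left a) * N[ right j ] (left a)) - ∑ (λ b → N[ right i ] (right b) * N[ right j ] (right b))
      ≡⟨ cong₂ _-_ (∑-cong (λ a → cong₂ _*_ (N-right-left i a) (N-right-left j a)))
                   (∑-cong (λ b → cong₂ _*_ (N-right-right i b) (N-right-right j b))) ⟩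
    ∑ (λ a → (1ℤ - δ i a) * (1ℤ - δ j a)) - ∑ (λ b → δ i b * δ j b)
      ≡⟨ cong₂ _-_ (∑-[1-δ]*[1-δ] i j) (∑-δˡ i (δ j)) ⟩
    (+ n - 1ℤ - (1ℤ - δ i j)) - δ j i
      ≡⟨ cong (λ d → (+ n - 1ℤ - (1ℤ - d)) - δ j i) (δ-comm i j) ⟩
    (+ n - 1ℤ - (1ℤ - δ j i)) - δ j i
      ≡⟨ simplify (+ n) (δ j i) ⟩
    + n - 1ℤ - 1ℤ ∎
    where
    open ≡-Reasoning
    simplify : ∀ k d → (k - 1ℤ - (1ℤ - d)) - d ≡ k - 1ℤ - 1ℤ
    simplify = solve-∀

  isLeft-proper : ∀ u v → adj G u v ≡ true → isLeft u ≡ not (isLeft v)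
  isLeft-proper u v with splitAt n u | splitAt n v
  ... | inj₁ _ | inj₂ _ = λ _ → refl
  ... | inj₂ _ | inj₁ _ = λ _ → refl
  ... | inj₁ _ | inj₁ _ = λ ()
  ... | inj₂ _ | inj₂ _ = λ ()

crown-4-cycle : ∀ k → HasCycle (Crown (4 ℕ.+ k)) 4
crown-4-cycle k = s≤s (s≤s (s≤s z≤n)) , f , f-injective , f-adj
  where
  open CrownGraph (4 ℕ.+ k)

  f : Fin 4 → Vertex
  f zero                   = left zero
  f (suc zero)             = right (suc zero)
  f (suc (suc zero))       = left (suc (suc zero))
  f (suc (suc (suc zero))) = right (suc (suc (suc zero)))

  toℕ-index-f : ∀ i → toℕ (index (f i)) ≡ toℕ i
  toℕ-index-f zero                   = cong toℕ (index-left zero)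
  toℕ-index-f (suc zero)             = cong toℕ (index-right (suc zero))
  toℕ-index-f (suc (suc zero))       = cong toℕ (index-left (suc (suc zero)))
  toℕ-index-f (suc (suc (suc zero))) = cong toℕ (index-right (suc (suc (suc zero))))

  f-injective : Injective _≡_ _≡_ f
  f-injective {i} {j} fi≡fj =
    Finₚ.toℕ-injective (trans (sym (toℕ-index-f i)) (trans (cong (toℕ ∘ index) fi≡fj) (toℕ-index-f j)))

  next : Fin 4 → Fin 4
  next zero                   = suc zero
  next (suc zero)             = suc (suc zero)
  next (suc (suc zero))       = suc (suc (suc zero))
  next (suc (suc (suc zero))) = zero

  f-adj-next : ∀ i → adj G (f i) (f (next i)) ≡ true
  f-adj-next zero                   = adj-left-right zero (suc zero)
  f-adj-next (suc zero)             = adj-right-left (suc (suc zero)) (suc zero)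
  f-adj-next (suc (suc zero))       = adj-left-right (suc (suc zero)) (suc (suc (suc zero)))
  f-adj-next (suc (suc (suc zero))) = adj-right-left zero (suc (suc (suc zero)))

  successor≡next : ∀ i j → toℕ j ≡ suc (toℕ i) ⊎ (suc (toℕ i) ≡ 4 × toℕ j ≡ 0) → j ≡ next i
  successor≡next (suc (suc (suc zero))) j (inj₁ j≡4) =
    ⊥-elim (ℕₚ.<-irrefl refl (subst (ℕ._< 4) j≡4 (Finₚ.toℕ<n j)))
  successor≡next (suc (suc (suc zero))) j (inj₂ (_ , j≡0)) = Finₚ.toℕ-injective j≡0
  successor≡next zero               j (inj₁ j≡i+1) = Finₚ.toℕ-injective j≡i+1
  successor≡next (suc zero)         j (inj₁ j≡i+1) = Finₚ.toℕ-injective j≡i+1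
  successor≡next (suc (suc zero))   j (inj₁ j≡i+1) = Finₚ.toℕ-injective j≡i+1

  f-adj : ∀ i j → toℕ j ≡ suc (toℕ i) ⊎ (suc (toℕ i) ≡ 4 × toℕ j ≡ 0) → adj G (f i) (f j) ≡ true
  f-adj i j succ = subst (λ j′ → adj G (f i) (f j′) ≡ true) (sym (successor≡next i j succ)) (f-adj-next i)

crown-girth : ∀ k → HasGirth (Crown (4 ℕ.+ k)) 4
crown-girth k = hasGirth-4 {G = G} (crown-4-cycle k) (bipartite⇒¬triangle {G = G} isLeft isLeft-proper)
  where open CrownGraph (4 ℕ.+ k)

module CrownLattice (k : ℕ) where
  open CrownGraph (3 ℕ.+ k)

  K : ℕ
  K = suc k

  pairRow-inLattice : ∀ u v → InLattice K sign (pairRow u v)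
  pairRow-inLattice u v with side u | side v
  ... | is-left i  | is-left j  = divides -1ℤ (trans (weight-left-left i j) (sym (ℤₚ.-1*i≡-i (+ K))))
  ... | is-left i  | is-right j = divides 0ℤ (weight-left-right i j)
  ... | is-right i | is-left j  = InLattice-resp {K = K} {sign} (pairRow-comm (left j) (right i))
                                    (divides 0ℤ (weight-left-right j i))
  ... | is-right i | is-right j = divides 1ℤ (trans (weight-right-right i j) (sym (ℤₚ.*-identityˡ (+ K))))

  RAMatrix-inLattice : ∀ i → InLattice K sign (RAMatrix G i)
  RAMatrix-inLattice = RAMatrix-rows G (InLattice K sign)
    (λ v → InLattice-resp {K = K} {sign} (λ w → cong 𝟙 (∧-idem (closedNbhd G v w))) (pairRow-inLattice v v))
    pairRow-inLattice

  isPairRow : Fin (length (raRows G)) → Bool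
  isPairRow = not ∘ firstRows (3 ℕ.+ k ℕ.+ (3 ℕ.+ k))

  Span : (Vertex → ℤ) → Set
  Span = InSpan (RAMatrix G) isPairRow

  open InSpanClosure (RAMatrix G) isPairRow

  pairRow∈ : ∀ {u v} → toℕ u ℕ.< toℕ v → Span (pairRow u v)
  pairRow∈ u<v = let (j , m≤j , eq) = RAMatrix-pairRow G u<v in
    InSpan-resp (λ w → cong (λ row → row w) eq) (InSpan-row j (cong not (≤⇒¬firstRow m≤j)))

  left<right : ∀ a b → toℕ (left a) ℕ.< toℕ (right b)
  left<right a b rewrite Finₚ.toℕ-↑ˡ a (3 ℕ.+ k) | Finₚ.toℕ-↑ʳ (3 ℕ.+ k) b =
    ℕₚ.<-≤-trans (Finₚ.toℕ<n a) (ℕₚ.m≤m+n _ (toℕ b))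

  pairRow-left-right : ∀ {a b} → ¬ a ≡ b → ∀ w → pairRow (left a) (right b) w ≡ δ (left a) w + δ (right b) w
  pairRow-left-right {a} {b} a≢b w with side w
  ... | is-left x = begin
    pairRow (left a) (right b) (left x)          ≡⟨ 𝟙-∧ (closedNbhd G (left a) (left x)) _ ⟩
    N[ left a ] (left x) * N[ right b ] (left x) ≡⟨ cong₂ _*_ (N-left-left a x) (N-right-left b x) ⟩
    δ a x * (1ℤ - δ b x)                         ≡⟨ δ*[1-δ]≡δ (a≢b ∘ sym) x ⟩
    δ a x                                        ≡⟨ ℤₚ.+-identityʳ (δ a x) ⟨
    δ a x + 0ℤ                                   ≡⟨ cong₂ _+_ (cong 𝟙 (does-left-left a x)) (cong 𝟙 (does-right-left x b)) ⟨
    δ (left a) (left x) + δ (right b) (left x)   ∎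
    where open ≡-Reasoning
  ... | is-right y = begin
    pairRow (left a) (right b) (right y)           ≡⟨ 𝟙-∧ (closedNbhd G (left a) (right y)) _ ⟩
    N[ left a ] (right y) * N[ right b ] (right y) ≡⟨ cong₂ _*_ (N-left-right a y) (N-right-right b y) ⟩
    (1ℤ - δ a y) * δ b y                           ≡⟨ ℤₚ.*-comm (1ℤ - δ a y) (δ b y) ⟩
    δ b y * (1ℤ - δ a y)                           ≡⟨ δ*[1-δ]≡δ a≢b y ⟩
    δ b y                                          ≡⟨ ℤₚ.+-identityˡ (δ b y) ⟨
    0ℤ + δ b y                                     ≡⟨ cong₂ _+_ (cong 𝟙 (does-left-right a y)) (cong 𝟙 (does-right-right b y)) ⟨
    δ (left a) (right y) + δ (right b) (right y)   ∎
    where open ≡-Reasoning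

  edge∈ : ∀ {a b} → ¬ a ≡ b → Span (λ w → δ (left a) w + δ (right b) w)
  edge∈ {a} {b} a≢b = InSpan-resp (pairRow-left-right a≢b) (pairRow∈ {left a} {right b} (left<right a b))

  two-others : (a : Fin (3 ℕ.+ k)) → Σ (Fin (3 ℕ.+ k)) λ c → Σ (Fin (3 ℕ.+ k)) λ d →
               ¬ a ≡ c × ¬ d ≡ c × ¬ d ≡ a
  two-others zero             = suc zero , suc (suc zero) , (λ ()) , (λ ()) , (λ ())
  two-others (suc zero)       = zero , suc (suc zero) , (λ ()) , (λ ()) , (λ ())
  two-others (suc (suc a))    = zero , suc zero , (λ ()) , (λ ()) , (λ ())

  -- For a = b: e_a + e_a′ = (e_a + e_c′) - (e_d + e_c′) + (e_d + e_a′) with a, c, d distinct.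
  left+right∈ : ∀ a b → Span (λ w → δ (left a) w + δ (right b) w)
  left+right∈ a b with a ≟ b
  ... | no  a≢b  = edge∈ a≢b
  ... | yes refl =
    let (c , d , a≢c , d≢c , d≢a) = two-others a in
    InSpan-resp (λ w → telescope (δ (left a) w) (δ (right c) w) (δ (left d) w) (δ (right a) w))
      (InSpan-+ (InSpan-- (edge∈ a≢c) (edge∈ d≢c)) (edge∈ d≢a))
    where
    telescope : ∀ x y z t → (x + y) - (z + y) + (z + t) ≡ x + t
    telescope = solve-∀

  e₀ : Vertex → ℤ
  e₀ = δ (left zero)

  e-sign·e₀∈ : ∀ u → Span (λ w → δ u w - sign u * e₀ w)
  e-sign·e₀∈ u with side u
  ... | is-left a  = InSpan-resp (λ w → trans (cancel (δ (left a) w) (e₀ w) (δ (right zero) w))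
                                              (cong (λ s → δ (left a) w - s * e₀ w) (sym (sign-left a))))
                       (InSpan-- (left+right∈ a zero) (left+right∈ zero zero))
    where
    cancel : ∀ x y z → (x + z) - (y + z) ≡ x - 1ℤ * y
    cancel = solve-∀
  ... | is-right b = InSpan-resp (λ w → trans (swap (e₀ w) (δ (right b) w))
                                              (cong (λ s → δ (right b) w - s * e₀ w) (sym (sign-right b))))
                       (left+right∈ zero b)
    where
    swap : ∀ x y → x + y ≡ y - -1ℤ * x
    swap = solve-∀

  x-weight·e₀∈ : ∀ x → Span (λ w → x w - weight x * e₀ w)
  x-weight·e₀∈ x = InSpan-resp expand
    (InSpan-∑ (λ u w → x u * (δ u w - sign u * e₀ w)) (λ u → InSpan-* (x u) (e-sign·e₀∈ u)))
    where
    expand : ∀ w → ∑ (λ u → x u * (δ u w - sign u * e₀ w)) ≡ x w - weight x * e₀ w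
    expand w = begin
      ∑ (λ u → x u * (δ u w - sign u * e₀ w))
        ≡⟨ ∑-cong (λ u → distrib (x u) (δ u w) (sign u) (e₀ w)) ⟩
      ∑ (λ u → x u * δ u w - sign u * x u * e₀ w)
        ≡⟨ ∑-distrib-- (λ u → x u * δ u w) (λ u → sign u * x u * e₀ w) ⟩
      ∑ (λ u → x u * δ u w) - ∑ (λ u → sign u * x u * e₀ w)
        ≡⟨ cong₂ _-_ (∑-δʳ w x) (sym (*-distribʳ-∑ (e₀ w) (λ u → sign u * x u))) ⟩
      x w - weight x * e₀ w ∎
      where
      open ≡-Reasoning
      distrib : ∀ a d s e → a * (d - s * e) ≡ a * d - s * a * e
      distrib = solve-∀

  K·e₀∈ : Span (λ w → + K * e₀ w)
  K·e₀∈ = InSpan-resp (λ w → trans (cong (λ c → P w - c * e₀ w - P w) weight[P]≡-K) (cancel (P w) (+ K) (e₀ w)))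
            (InSpan-- (x-weight·e₀∈ P) (pairRow∈ {left (suc zero)} {left (suc (suc zero))} (s≤s (s≤s z≤n))))
    where
    P : Vertex → ℤ
    P = pairRow (left (suc zero)) (left (suc (suc zero)))
    weight[P]≡-K : weight P ≡ - + K
    weight[P]≡-K = weight-left-left (suc zero) (suc (suc zero))
    cancel : ∀ p k e → p - - k * e - p ≡ k * e
    cancel = solve-∀

  lattice⊆Span : ∀ x → InLattice K sign x → Span x
  lattice⊆Span x (divides q weight≡qK) =
    InSpan-resp (λ w → trans (cong (λ c → x w - c * e₀ w + q * (+ K * e₀ w)) weight≡qK)
                             (cancel (x w) q (+ K) (e₀ w)))
      (InSpan-+ (x-weight·e₀∈ x) (InSpan-* q K·e₀∈))
    where
    cancel : ∀ a q k e → a - q * k * e + q * (k * e) ≡ a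
    cancel = solve-∀

  crown-isRA : IsRA (Crown (3 ℕ.+ k)) K
  crown-isRA = isRA-of-lattice G K sign sign² (m≤#raRows G) RAMatrix-inLattice lattice⊆Span

mainTheorem15 : ∀ (n : ℕ) → 4 ≤ n → HasGirth (Crown n) 4 × IsRA (Crown n) (n ∸ 2)
mainTheorem15 _ (s≤s (s≤s (s≤s (s≤s {n = k} _)))) = crown-girth k , CrownLattice.crown-isRA (suc k)
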